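{- Let $G$ be a connected graph of order $n\geq 4$ and $C(G)$ its central graph, with $V_1=V(G)$ and $V_2=V(C(G))\setminus V(G)$. If $\varphi\in Aut(C(G))$, then $\varphi(V_1)=V_1$ and $\varphi(V_2)=V_2$.
   Context: All graphs are simple, finite, undirected. The central graph $C(G)$ has vertex set $V(G)\cup\{w_{u,v}:\{u,v\}\in E(G)\}$ and edge set consisting of all pairs of distinct non-adjacent vertices of $G$, together with $\{u,w_{u,v}\}$ and $\{w_{u,v},v\}$ for every $\{u,v\}\in E(G)$. -}

module Defs where

open import Data.Nat using (ℕ)
open import Data.Fin using (Fin; _<_)
open import Data.Bool using (Bool; true; false; T)
open import Data.Product using (Σ; Σ-syntax; _×_; _,_; ∃-syntax)
open import Data.Sum using (_⊎_; inj₁; inj₂)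
open import Data.Empty using (⊥)
open import Relation.Nullary using (¬_)
open import Relation.Binary.PropositionalEquality using (_≡_)
open import Function.Bundles using (_↔_; Inverse; _⇔_)

record Graph (n : ℕ) : Set where
  field
    adj   : Fin n → Fin n → Bool
    sym   : ∀ u v → adj u v ≡ adj v u
    irrfl : ∀ u → adj u u ≡ false
open Graph public

Adj : ∀ {n} → Graph n → Fin n → Fin n → Set
Adj G u v = T (adj G u v)

data Reach {n} (G : Graph n) : Fin n → Fin n → Set where
  here : ∀ {u} → Reach G u u
  step : ∀ {u v w} → Adj G u v → Reach G v w → Reach G u w

Connected : ∀ {n} → Graph n → Set
Connected {n} G = ∀ (u v : Fin n) → Reach G u v

-- Edges of G, each unordered edge {u,v} represented once as (u , v) with u < v.
Edge : ∀ {n} → Graph n → Set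
Edge {n} G = Σ[ u ∈ Fin n ] Σ[ v ∈ Fin n ] (u < v × Adj G u v)

-- Vertices of the central graph C(G): V(G) ⊎ {w_{u,v} : {u,v} ∈ E(G)}
CVert : ∀ {n} → Graph n → Set
CVert {n} G = Fin n ⊎ Edge G

CAdj : ∀ {n} (G : Graph n) → CVert G → CVert G → Set
CAdj {n} G (inj₁ x) (inj₁ y) = ¬ (x ≡ y) × adj G x y ≡ false
CAdj {n} G (inj₁ x) (inj₂ (u , v , _)) = x ≡ u ⊎ x ≡ v
CAdj {n} G (inj₂ (u , v , _)) (inj₁ x) = x ≡ u ⊎ x ≡ v
CAdj {n} G (inj₂ _) (inj₂ _) = ⊥

record CAut {n} (G : Graph n) : Set where
  field
    bij : CVert G ↔ CVert G
    hom : ∀ a b → CAdj G a b ⇔ CAdj G (Inverse.to bij a) (Inverse.to bij b)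
open CAut public

map : ∀ {n} {G : Graph n} → CAut G → CVert G → CVert G
map φ = Inverse.to (bij φ)

InV₁ : ∀ {n} {G : Graph n} → CVert G → Set
InV₁ {n} {G} a = Σ[ x ∈ Fin n ] a ≡ inj₁ x

InV₂ : ∀ {n} {G : Graph n} → CVert G → Set
InV₂ {n} {G} a = Σ[ e ∈ Edge G ] a ≡ inj₂ e

-- φ(S) = S for a predicate S on vertices, as set equality of the image.
MapsOnto : ∀ {n} {G : Graph n} → CAut G → (CVert G → Set) → Set
MapsOnto {G = G} φ S =
  (∀ a → S a → S (map φ a)) × (∀ b → S b → ∃[ a ] (S a × map φ a ≡ b))

{-# OPTIONS --safe #-}

-- In C(G) a vertex x of G is adjacent to every other vertex y of G: directly
-- if xy ∉ E(G), and through the subdivision vertex w_{x,y} otherwise. Hence x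
-- has degree n - 1 ≥ 3, while every subdivision vertex has degree 2. Being of
-- degree at least 3 is preserved by automorphisms, so V₁ and V₂ are invariant.
module Submission where

open import Defs hiding (sym)
open import Data.Bool using (true; false; if_then_else_; T)
open import Data.Bool.Properties using (T-≡)
open import Data.Empty using (⊥-elim)
open import Data.Fin using (Fin; zero; suc; _≟_; punchIn; inject≤)
open import Data.Fin.Properties
  using (<-cmp; punchInᵢ≢i; punchIn-injective; inject≤-injective; injective⇒≤)
open import Data.Nat using (ℕ; suc; _≤_; _≥_; s≤s)
open import Data.Nat.Properties using (1+n≰n)
open import Data.Product using (Σ-syntax; _×_; _,_; proj₁; proj₂)
open import Data.Sum using (inj₁; inj₂)
open import Function using (_∘_)
open import Function.Bundles using (Inverse; Injection; Equivalence; mk⇔; _⇔_)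
import Function.Properties.Equivalence as ⇔
open import Function.Properties.Inverse using (↔⇒↣; ↔-sym)
open import Function.Definitions using (Injective)
open import Relation.Binary.Definitions using (tri<; tri≈; tri>)
open import Relation.Binary.PropositionalEquality
  using (_≡_; _≢_; refl; sym; cong; subst; subst₂; module ≡-Reasoning)
open import Relation.Nullary using (¬_; does; contraposition)
open import Relation.Nullary.Decidable using (dec-true; dec-false)

¬-⇔ : ∀ {A B : Set} → A ⇔ B → (¬ A) ⇔ (¬ B)
¬-⇔ A⇔B =
  mk⇔ (contraposition (Equivalence.from A⇔B)) (contraposition (Equivalence.to A⇔B))

module _ {n : ℕ} (G : Graph n) where

  DegreeAtLeast : ℕ → CVert G → Set
  DegreeAtLeast k a =
    Σ[ f ∈ (Fin k → CVert G) ] Injective _≡_ _≡_ f × (∀ i → CAdj G a (f i))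

  DegreeAtLeast-mono : ∀ {k l a} → k ≤ l → DegreeAtLeast l a → DegreeAtLeast k a
  DegreeAtLeast-mono k≤l (f , f-inj , f-adj) =
    f ∘ (λ i → inject≤ i k≤l) ,
    inject≤-injective k≤l k≤l _ _ ∘ f-inj ,
    f-adj ∘ (λ i → inject≤ i k≤l)

  DegreeAtLeast-map : (h : CVert G → CVert G) → Injective _≡_ _≡_ h →
    (∀ a b → CAdj G a b → CAdj G (h a) (h b)) →
    ∀ {k a} → DegreeAtLeast k a → DegreeAtLeast k (h a)
  DegreeAtLeast-map h h-inj h-adj {a = a} (f , f-inj , f-adj) =
    h ∘ f , f-inj ∘ h-inj , h-adj a _ ∘ f-adj

  endpointIndex : ∀ {e b} → CAdj G (inj₂ e) b → Fin 2
  endpointIndex {b = inj₁ _} (inj₁ _) = zero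
  endpointIndex {b = inj₁ _} (inj₂ _) = suc zero

  endpointIndex-injective : ∀ {e b c}
    (p : CAdj G (inj₂ e) b) (q : CAdj G (inj₂ e) c) →
    endpointIndex p ≡ endpointIndex q → b ≡ c
  endpointIndex-injective {b = inj₁ _} {inj₁ _} (inj₁ refl) (inj₁ refl) _ = refl
  endpointIndex-injective {b = inj₁ _} {inj₁ _} (inj₂ refl) (inj₂ refl) _ = refl
  endpointIndex-injective {b = inj₁ _} {inj₁ _} (inj₁ _) (inj₂ _) ()
  endpointIndex-injective {b = inj₁ _} {inj₁ _} (inj₂ _) (inj₁ _) ()

  subdivision-degree≤2 : ∀ {k e} → DegreeAtLeast k (inj₂ e) → k ≤ 2
  subdivision-degree≤2 (f , f-inj , f-adj) =
    injective⇒≤ (f-inj ∘ endpointIndex-injective (f-adj _) (f-adj _))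

  otherEnd : Fin n → Edge G → Fin n
  otherEnd x (u , v , _) = if does (u ≟ x) then v else u

  farEnd : Fin n → CVert G → Fin n
  farEnd x (inj₁ y) = y
  farEnd x (inj₂ e) = otherEnd x e

  neighbourTowards : ∀ x y → y ≢ x →
    Σ[ b ∈ CVert G ] CAdj G (inj₁ x) b × farEnd x b ≡ y
  neighbourTowards x y y≢x with adj G x y in xy
  ... | false = inj₁ y , (y≢x ∘ sym , xy) , refl
  ... | true with <-cmp x y
  ...   | tri< x<y _ _ =
          inj₂ (x , y , x<y , Equivalence.from T-≡ xy) , inj₁ refl ,
          cong (if_then y else x) (dec-true (x ≟ x) refl)
  ...   | tri≈ _ x≡y _ = ⊥-elim (y≢x (sym x≡y))
  ...   | tri> _ _ y<x =
          inj₂ (y , x , y<x , subst T (Graph.sym G x y) (Equivalence.from T-≡ xy)) ,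
          inj₂ refl ,
          cong (if_then x else y) (dec-false (y ≟ x) y≢x)

module _ {m : ℕ} (G : Graph (suc m)) where

  vertex-degree : ∀ x → DegreeAtLeast G m (inj₁ x)
  vertex-degree x = neighbour , neighbour-injective , proj₁ ∘ proj₂ ∘ towards
    where
    towards : (i : Fin m) →
      Σ[ b ∈ CVert G ] CAdj G (inj₁ x) b × farEnd G x b ≡ punchIn x i
    towards i = neighbourTowards G x (punchIn x i) (punchInᵢ≢i x i)

    neighbour : Fin m → CVert G
    neighbour = proj₁ ∘ towards

    neighbour-injective : Injective _≡_ _≡_ neighbour
    neighbour-injective {i} {j} eq = punchIn-injective x i j (begin
      punchIn x i                ≡⟨ sym (proj₂ (proj₂ (towards i))) ⟩
      farEnd G x (neighbour i)   ≡⟨ cong (farEnd G x) eq ⟩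
      farEnd G x (neighbour j)   ≡⟨ proj₂ (proj₂ (towards j)) ⟩
      punchIn x j                ∎)
      where open ≡-Reasoning

  InV₁⇔degree≥3 : 3 ≤ m → ∀ a → InV₁ {G = G} a ⇔ DegreeAtLeast G 3 a
  InV₁⇔degree≥3 3≤m (inj₁ x) =
    mk⇔ (λ _ → DegreeAtLeast-mono G 3≤m (vertex-degree x)) (λ _ → x , refl)
  InV₁⇔degree≥3 3≤m (inj₂ e) =
    mk⇔ (λ { (_ , ()) }) (⊥-elim ∘ 1+n≰n ∘ subdivision-degree≤2 G)

  InV₂⇔degree<3 : 3 ≤ m → ∀ a → InV₂ {G = G} a ⇔ (¬ DegreeAtLeast G 3 a)
  InV₂⇔degree<3 3≤m (inj₁ x) =
    mk⇔ (λ { (_ , ()) })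
        (λ ¬deg → ⊥-elim (¬deg (DegreeAtLeast-mono G 3≤m (vertex-degree x))))
  InV₂⇔degree<3 3≤m (inj₂ e) =
    mk⇔ (λ _ → 1+n≰n ∘ subdivision-degree≤2 G) (λ _ → e , refl)

module _ {n : ℕ} {G : Graph n} (φ : CAut G) where
  open Inverse (bij φ)

  from-preserves-adjacency : ∀ a b → CAdj G a b → CAdj G (from a) (from b)
  from-preserves-adjacency a b =
    Equivalence.from (hom φ (from a) (from b)) ∘
    subst₂ (CAdj G) (sym (strictlyInverseˡ a)) (sym (strictlyInverseˡ b))

  DegreeAtLeast-aut : ∀ {k} a → DegreeAtLeast G k a ⇔ DegreeAtLeast G k (map φ a)
  DegreeAtLeast-aut {k} a = mk⇔
    (DegreeAtLeast-map G to (Injection.injective (↔⇒↣ (bij φ)))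
      (λ a b → Equivalence.to (hom φ a b)))
    (subst (DegreeAtLeast G k) (strictlyInverseʳ a) ∘
      DegreeAtLeast-map G from (Injection.injective (↔⇒↣ (↔-sym (bij φ))))
        from-preserves-adjacency)

  mapsOnto-invariant : (S : CVert G → Set) → (∀ a → S a ⇔ S (map φ a)) →
    MapsOnto φ S
  mapsOnto-invariant S S-inv =
    (λ a → Equivalence.to (S-inv a)) ,
    (λ b Sb → from b ,
      Equivalence.from (S-inv (from b)) (subst S (sym (strictlyInverseˡ b)) Sb) ,
      strictlyInverseˡ b)

  mapsOnto-characterised : (S P : CVert G → Set) → (∀ a → S a ⇔ P a) →
    (∀ a → P a ⇔ P (map φ a)) → MapsOnto φ S
  mapsOnto-characterised S P S⇔P P-inv = mapsOnto-invariant S λ a →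
    ⇔.trans (S⇔P a) (⇔.trans (P-inv a) (⇔.sym (S⇔P (map φ a))))

lemma2p4 : ∀ (n : ℕ) (G : Graph n) → n ≥ 4 → Connected G →
    (φ : CAut G) → MapsOnto φ (InV₁ {G = G}) × MapsOnto φ (InV₂ {G = G})
lemma2p4 (suc m) G (s≤s 3≤m) _ φ =
  mapsOnto-characterised φ (InV₁ {G = G}) (DegreeAtLeast G 3)
    (InV₁⇔degree≥3 G 3≤m) (DegreeAtLeast-aut φ) ,
  mapsOnto-characterised φ (InV₂ {G = G}) (¬_ ∘ DegreeAtLeast G 3)
    (InV₂⇔degree<3 G 3≤m) (¬-⇔ ∘ DegreeAtLeast-aut φ)
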